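{- Let $\mathfrak{s}$ be a cluster in a chromatic cluster picture on a set of roots $\mathcal{R}=\mathcal{R}_1\sqcup\mathcal{R}_2$ with $\mathcal{R}_1$ the red roots and $\mathcal{R}_2$ the blue roots. If $|\mathfrak{s}|$ is odd then $\mathfrak{s}$ is red or blue, and if $|\mathfrak{s}|$ is even then $\mathfrak{s}$ is purple or black. Furthermore: if $\mathfrak{s}$ is purple then $|\mathfrak{s}\cap\mathcal{R}_1|$ and $|\mathfrak{s}\cap\mathcal{R}_2|$ are odd and $|\mathfrak{s}|$ is even; if $\mathfrak{s}$ is red then $|\mathfrak{s}\cap\mathcal{R}_1|$ and $|\mathfrak{s}|$ are odd and $|\mathfrak{s}\cap\mathcal{R}_2|$ is even; if $\mathfrak{s}$ is blue then $|\mathfrak{s}\cap\mathcal{R}_2|$ and $|\mathfrak{s}|$ are odd and $|\mathfrak{s}\cap\mathcal{R}_1|$ is even; and if $\mathfrak{s}$ is black then $|\mathfrak{s}\cap\mathcal{R}_1|$, $|\mathfrak{s}\cap\mathcal{R}_2|$ and $|\mathfrak{s}|$ are all even.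
   Context: A cluster picture on a finite set $\mathcal{R}\subset\bar K$ ($K$ a local field with valuation $v_K$) is the set of clusters: nonempty subsets $\mathfrak{s}=D\cap\mathcal{R}$ for discs $D=\{x: v_K(x-z)\ge d\}$, $z\in\bar K$, $d\in\mathbb{Q}$. A child of $\mathfrak{s}$ is a maximal cluster strictly contained in $\mathfrak{s}$. In a chromatic cluster picture each root is coloured red or blue (singleton clusters carry the colour of their root), and every other cluster is coloured: red if it has an odd number of red children and an even number of blue children; blue if it has an odd number of blue children and an even number of red children; purple if it has an odd number of red and an odd number of blue children; black otherwise. Here a purple child is counted both as a red child and as a blue child. (In the paper, the parity of $\mathfrak{s}$ in the red cluster picture $\Sigma_1$, resp. blue cluster picture $\Sigma_2$, resp. $\Sigma$, is the parity of $|\mathfrak{s}\cap\mathcal{R}_1|$, resp. $|\mathfrak{s}\cap\mathcal{R}_2|$, resp. $|\mathfrak{s}|$.) -}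

module Defs where

open import Data.Nat using (ℕ; zero; suc; _+_; _%_)
open import Data.Bool using (Bool; true; false)
open import Data.Fin using (Fin)
open import Data.Fin.Subset using (Subset; _∈_; _⊂_; _∩_; ∣_∣; Nonempty)
open import Data.Vec using (tabulate)
open import Data.List using (List; []; _∷_)
open import Data.List.Membership.Propositional using () renaming (_∈_ to _∈ₗ_)
open import Data.List.Relation.Unary.Unique.Propositional using (Unique)
open import Data.Rational using (ℚ; _≤_)
open import Data.Product using (_×_; Σ; ∃)
open import Data.Unit using (⊤)
open import Data.Empty using (⊥)
open import Function using (_⇔_)
open import Function.Definitions using (Injective)
open import Relation.Binary.PropositionalEquality using (_≡_)

Even : ℕ → Set
Even n = n % 2 ≡ 0

Odd : ℕ → Set
Odd n = n % 2 ≡ 1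

-- Valuations with values in ℚ ∪ {∞}  (v(0) = ∞)

data ℚ∞ : Set where
  fin : ℚ → ℚ∞
  ∞   : ℚ∞

_≤∞_ : ℚ → ℚ∞ → Set
d ≤∞ fin q = d ≤ q
d ≤∞ ∞     = ⊤

-- Abstraction of (K̄, (x,y) ↦ v_K(x - y)): a set with an ultrametric
-- "valuation of the difference" taking values in ℚ ∪ {∞}.
record UltrametricSpace : Set₁ where
  field
    Point    : Set
    val      : Point → Point → ℚ∞
    val-self : ∀ x → val x x ≡ ∞
    val-∞    : ∀ x y → val x y ≡ ∞ → x ≡ y
    val-sym  : ∀ x y → val x y ≡ val y x
    val-ultra : ∀ x y z d → d ≤∞ val x y → d ≤∞ val y z → d ≤∞ val x z

data RootColour : Set where
  red blue : RootColour

data Colour : Set where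
  red blue purple black : Colour

rootToColour : RootColour → Colour
rootToColour red  = red
rootToColour blue = blue

isRedRoot : RootColour → Bool
isRedRoot red  = true
isRedRoot blue = false

isBlueRoot : RootColour → Bool
isBlueRoot red  = false
isBlueRoot blue = true

redWeight : Colour → ℕ
redWeight red    = 1
redWeight purple = 1
redWeight _      = 0

blueWeight : Colour → ℕ
blueWeight blue   = 1
blueWeight purple = 1
blueWeight _      = 0

parity : ℕ → Bool
parity zero    = false
parity (suc n) = Data.Bool.not (parity n)
  where import Data.Bool

colourFromCounts : ℕ → ℕ → Colour
colourFromCounts r b with parity r | parity b
... | true  | false = red
... | false | true  = blue
... | true  | true  = purple
... | false | false = black

module ClusterPicture (U : UltrametricSpace) {n : ℕ} (root : Fin n → UltrametricSpace.Point U) where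
  open UltrametricSpace U

  IsDiscCut : Subset n → Point → ℚ → Set
  IsDiscCut s z d = ∀ i → (i ∈ s ⇔ d ≤∞ val (root i) z)

  IsCluster : Subset n → Set
  IsCluster s = Nonempty s × (∃ λ z → ∃ λ d → IsDiscCut s z d)

  IsChild : Subset n → Subset n → Set
  IsChild s t = IsCluster t × t ⊂ s × (∀ u → IsCluster u → t ⊂ u → u ⊂ s → ⊥)

  ChildList : Subset n → List (Subset n) → Set
  ChildList s L = Unique L × (∀ t → t ∈ₗ L ⇔ IsChild s t)

  module _ (col : Subset n → Colour) where
    redChildren : List (Subset n) → ℕ
    redChildren []      = 0
    redChildren (t ∷ L) = redWeight (col t) + redChildren L

    blueChildren : List (Subset n) → ℕ
    blueChildren []      = 0
    blueChildren (t ∷ L) = blueWeight (col t) + blueChildren L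

  -- col is the chromatic colouring of the clusters induced by the
  -- root colouring rc (defined recursively in the paper; here as the
  -- defining equations, which determine col on clusters uniquely)
  record IsChromatic (rc : Fin n → RootColour) (col : Subset n → Colour) : Set where
    field
      singleton : ∀ s i → IsCluster s → ∣ s ∣ ≡ 1 → i ∈ s → col s ≡ rootToColour (rc i)
      nonSingleton : ∀ s L → IsCluster s → ChildList s L → (∣ s ∣ ≡ 1 → ⊥) →
                     col s ≡ colourFromCounts (redChildren col L) (blueChildren col L)

  R₁ : (Fin n → RootColour) → Subset n
  R₁ rc = tabulate (λ i → isRedRoot (rc i))

  R₂ : (Fin n → RootColour) → Subset n
  R₂ rc = tabulate (λ i → isBlueRoot (rc i))

-- The colour of every cluster s is colourFromCounts ∣ s ∩ R₁ ∣ ∣ s ∩ R₂ ∣, i.e. it depends only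
-- on the parities of the numbers of red and of blue roots in s; the six claims then follow from
-- ∣ s ∣ = ∣ s ∩ R₁ ∣ + ∣ s ∩ R₂ ∣. A
-- non-singleton cluster s of depth m (the least v(r - r′) for r, r′ ∈ s) is partitioned by its
-- children, which are the open discs {x : v(x - r) > m} around its roots. As a purple child
-- counts both as red and as blue, the number of red children of s therefore has the parity of
-- the number of red roots of s, and likewise for blue.
module Submission where

open import Defs
open import Data.Bool using (Bool; true; false; _∧_; _xor_; not)
open import Data.Bool.Properties using (not-involutive) renaming (_≟_ to _≟ᴮ_)
open import Data.Empty using (⊥-elim)
open import Data.Fin using (Fin; zero; suc)
open import Data.Fin.Subset using (Subset; _∈_; _∉_; _⊆_; _⊂_; _∩_; ∣_∣; ⁅_⁆)
open import Data.Fin.Subset.Induction using (Acc; acc; ⊂-wellFounded)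
open import Data.Fin.Subset.Properties
  using (_∈?_; ⊆-antisym; x∈⁅x⁆; x∈⁅y⁆⇒x≡y; ∣⁅x⁆∣≡1; p⊂q⇒p⊆q; x∈p∩q⁺; x∈p⇒∣p-x∣<∣p∣)
open import Data.List using (List; []; _∷_; map; filter; allFin; deduplicate)
open import Data.List.Membership.Propositional using () renaming (_∈_ to _∈ₗ_)
open import Data.List.Membership.Propositional.Properties
  using (∈-filter⁺; ∈-filter⁻; ∈-map⁺; ∈-map⁻; deduplicate-∈⇔; ∈-allFin)
open import Data.List.Properties using (map-cong; map-∘)
open import Data.List.Relation.Unary.All using () renaming (lookup to lookupᴬ)
open import Data.List.Relation.Unary.AllPairs using (_∷_)
open import Data.List.Relation.Unary.Any using (here; there)
open import Data.List.Relation.Unary.Unique.Propositional using (Unique)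
open import Data.Nat using (ℕ; zero; suc; _+_; _*_; _%_; _≤_; z≤n; _≟_)
open import Data.Nat.ListAction using (sum)
open import Data.Nat.Properties using (+-suc; *-distribʳ-+; 1+n≢0; ≤-<-trans; +-commutativeSemigroup)
open import Algebra.Properties.CommutativeSemigroup +-commutativeSemigroup using (interchange)
open import Data.Product using (_×_; _,_; ∃; ∃-syntax; proj₁; proj₂)
open import Data.Rational using (ℚ; _<_; _≤?_; _<?_; 1ℚ) renaming (_+_ to _+ℚ_; _≤_ to _≤ℚ_)
open import Data.Rational.Properties
  using (≤-refl; ≤-trans; <⇒≤; ≰⇒>; <-≤-trans; <-irrefl; ≤-total; +-identityʳ; +-monoʳ-<; positive⁻¹)
open import Data.Sum using (_⊎_; inj₁; inj₂)
open import Data.Unit using (⊤; tt)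
open import Data.Vec using (_∷_; []; lookup; tail; tabulate)
open import Data.Vec.Properties using ([]=⇒lookup; lookup⇒[]=; lookup∘tabulate; ≡-dec)
open import Function using (_∘_; mk⇔; Equivalence)
open import Function.Definitions using (Injective)
open import Relation.Nullary using (¬_; Dec; yes; no; does; contradiction)
open import Relation.Nullary.Decidable using (dec-true)
open import Relation.Unary using (Decidable)
open import Relation.Binary.PropositionalEquality
  using (_≡_; _≢_; refl; sym; trans; cong; cong₂; subst; module ≡-Reasoning)

open Equivalence using (to; from)

toℕ : Bool → ℕ
toℕ false = 0
toℕ true  = 1

toℕ-∧ : ∀ a b → toℕ (a ∧ b) ≡ toℕ a * toℕ b
toℕ-∧ false b     = refl
toℕ-∧ true  false = refl
toℕ-∧ true  true  = refl

parity-+ : ∀ a b → parity (a + b) ≡ parity a xor parity b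
parity-+ zero    b = refl
parity-+ (suc a) b with parity a | parity-+ a b
... | true  | p = trans (cong not p) (not-involutive _)
... | false | p = cong not p

%2≡toℕ∘parity : ∀ n → n % 2 ≡ toℕ (parity n)
%2≡toℕ∘parity zero          = refl
%2≡toℕ∘parity (suc zero)    = refl
%2≡toℕ∘parity (suc (suc n)) = trans (%2≡toℕ∘parity n) (cong toℕ (sym (not-involutive (parity n))))

parity≡true⇒Odd : ∀ n → parity n ≡ true → Odd n
parity≡true⇒Odd n p = trans (%2≡toℕ∘parity n) (cong toℕ p)

parity≡false⇒Even : ∀ n → parity n ≡ false → Even n
parity≡false⇒Even n p = trans (%2≡toℕ∘parity n) (cong toℕ p)

Odd⇒¬Even : ∀ n → Odd n → ¬ Even n
Odd⇒¬Even n o e = 1+n≢0 (trans (sym o) e)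

colourFromCounts-cong : ∀ {r r′ b b′} → parity r ≡ parity r′ → parity b ≡ parity b′ →
                        colourFromCounts r b ≡ colourFromCounts r′ b′
colourFromCounts-cong pr pb rewrite pr | pb = refl

parity-redWeight : ∀ r b → parity (redWeight (colourFromCounts r b)) ≡ parity r
parity-redWeight r b with parity r | parity b
... | true  | true  = refl
... | true  | false = refl
... | false | true  = refl
... | false | false = refl

parity-blueWeight : ∀ r b → parity (blueWeight (colourFromCounts r b)) ≡ parity b
parity-blueWeight r b with parity r | parity b
... | true  | true  = refl
... | true  | false = refl
... | false | true  = refl
... | false | false = refl

colourFromCounts-red : ∀ r b → r + b ≡ 1 → 1 ≤ r → colourFromCounts r b ≡ red
colourFromCounts-red 1 0 _ _ = refl
colourFromCounts-red (suc (suc _)) _ () _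
colourFromCounts-red 1 (suc _) () _

colourFromCounts-blue : ∀ r b → r + b ≡ 1 → 1 ≤ b → colourFromCounts r b ≡ blue
colourFromCounts-blue 0 1 _ _ = refl
colourFromCounts-blue 0 (suc (suc _)) () _
colourFromCounts-blue (suc zero) (suc _) () _
colourFromCounts-blue (suc (suc _)) (suc _) () _

colourFromCounts-classification : ∀ a b → let c = colourFromCounts a b in
  (Odd (a + b) → c ≡ red ⊎ c ≡ blue) ×
  (Even (a + b) → c ≡ purple ⊎ c ≡ black) ×
  (c ≡ purple → Odd a × Odd b × Even (a + b)) ×
  (c ≡ red → Odd a × Even b × Odd (a + b)) ×
  (c ≡ blue → Even a × Odd b × Odd (a + b)) ×
  (c ≡ black → Even a × Even b × Even (a + b))
colourFromCounts-classification a b with parity a in pa | parity b in pb | parity-+ a b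
... | true  | false | p+ =
  (λ _ → inj₁ refl) ,
  (λ e → contradiction e (Odd⇒¬Even (a + b) (parity≡true⇒Odd (a + b) p+))) ,
  (λ ()) ,
  (λ _ → parity≡true⇒Odd a pa , parity≡false⇒Even b pb , parity≡true⇒Odd (a + b) p+) ,
  (λ ()) ,
  (λ ())
... | false | true  | p+ =
  (λ _ → inj₂ refl) ,
  (λ e → contradiction e (Odd⇒¬Even (a + b) (parity≡true⇒Odd (a + b) p+))) ,
  (λ ()) ,
  (λ ()) ,
  (λ _ → parity≡false⇒Even a pa , parity≡true⇒Odd b pb , parity≡true⇒Odd (a + b) p+) ,
  (λ ())
... | true  | true  | p+ =
  (λ o → contradiction (parity≡false⇒Even (a + b) p+) (Odd⇒¬Even (a + b) o)) ,
  (λ _ → inj₁ refl) ,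
  (λ _ → parity≡true⇒Odd a pa , parity≡true⇒Odd b pb , parity≡false⇒Even (a + b) p+) ,
  (λ ()) ,
  (λ ()) ,
  (λ ())
... | false | false | p+ =
  (λ o → contradiction (parity≡false⇒Even (a + b) p+) (Odd⇒¬Even (a + b) o)) ,
  (λ _ → inj₂ refl) ,
  (λ ()) ,
  (λ ()) ,
  (λ ()) ,
  (λ _ → parity≡false⇒Even a pa , parity≡false⇒Even b pb , parity≡false⇒Even (a + b) p+)

sum-map-≡0 : ∀ {A : Set} {f : A → ℕ} xs → (∀ {x} → x ∈ₗ xs → f x ≡ 0) → sum (map f xs) ≡ 0
sum-map-≡0 []       h = refl
sum-map-≡0 (x ∷ xs) h = cong₂ _+_ (h (here refl)) (sum-map-≡0 xs (h ∘ there))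

sum-map-+ : ∀ {A : Set} (f g : A → ℕ) xs →
            sum (map (λ x → f x + g x) xs) ≡ sum (map f xs) + sum (map g xs)
sum-map-+ f g []       = refl
sum-map-+ f g (x ∷ xs) = trans (cong (f x + g x +_) (sum-map-+ f g xs)) (interchange (f x) (g x) _ _)

sum-map-*ʳ : ∀ {A : Set} (f : A → ℕ) c xs → sum (map (λ x → f x * c) xs) ≡ sum (map f xs) * c
sum-map-*ʳ f c []       = refl
sum-map-*ʳ f c (x ∷ xs) = trans (cong (f x * c +_) (sum-map-*ʳ f c xs)) (sym (*-distribʳ-+ c (f x) _))

parity-sum-map-cong : ∀ {A : Set} {f g : A → ℕ} xs → (∀ {x} → x ∈ₗ xs → parity (f x) ≡ parity (g x)) →
                      parity (sum (map f xs)) ≡ parity (sum (map g xs))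
parity-sum-map-cong []               h = refl
parity-sum-map-cong {f = f} {g} (x ∷ xs) h = begin
  parity (f x + sum (map f xs))            ≡⟨ parity-+ (f x) _ ⟩
  parity (f x) xor parity (sum (map f xs))
    ≡⟨ cong₂ _xor_ (h (here refl)) (parity-sum-map-cong xs (h ∘ there)) ⟩
  parity (g x) xor parity (sum (map g xs)) ≡⟨ sym (parity-+ (g x) _) ⟩
  parity (g x + sum (map g xs))            ∎
  where open ≡-Reasoning

∣∷∣ : ∀ {n} b (p : Subset n) → ∣ b ∷ p ∣ ≡ toℕ b + ∣ p ∣
∣∷∣ true  p = refl
∣∷∣ false p = refl

toℕ-lookup-∈ : ∀ {n} {p : Subset n} {k} → k ∈ p → toℕ (lookup p k) ≡ 1
toℕ-lookup-∈ k∈p = cong toℕ ([]=⇒lookup k∈p)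

toℕ-lookup-∉ : ∀ {n} {p : Subset n} {k} → k ∉ p → toℕ (lookup p k) ≡ 0
toℕ-lookup-∉ {p = p} {k} k∉p with lookup p k in e
... | false = refl
... | true  = contradiction (lookup⇒[]= k p e) k∉p

∈-tabulate⁺ : ∀ {n} {f : Fin n → Bool} {i} → f i ≡ true → i ∈ tabulate f
∈-tabulate⁺ {f = f} {i} fi = lookup⇒[]= i _ (trans (lookup∘tabulate f i) fi)

∈⇒1≤∣∣ : ∀ {n} {p : Subset n} {x} → x ∈ p → 1 ≤ ∣ p ∣
∈⇒1≤∣∣ x∈p = ≤-<-trans z≤n (x∈p⇒∣p-x∣<∣p∣ x∈p)

∣∣≡∣∩red∣+∣∩blue∣ : ∀ {n} (rc : Fin n → RootColour) (s : Subset n) →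
  ∣ s ∣ ≡ ∣ s ∩ tabulate (isRedRoot ∘ rc) ∣ + ∣ s ∩ tabulate (isBlueRoot ∘ rc) ∣
∣∣≡∣∩red∣+∣∩blue∣ rc []      = refl
∣∣≡∣∩red∣+∣∩blue∣ rc (b ∷ s) with rc zero | b | ∣∣≡∣∩red∣+∣∩blue∣ (rc ∘ suc) s
... | red  | true  | ih = cong suc ih
... | blue | true  | ih = trans (cong suc ih) (sym (+-suc _ _))
... | _    | false | ih = ih

multiplicity : ∀ {n} → List (Subset n) → Fin n → ℕ
multiplicity L k = sum (map (λ t → toℕ (lookup t k)) L)

multiplicity-≡0 : ∀ {n} {L : List (Subset n)} {k} → (∀ {t} → t ∈ₗ L → k ∉ t) → multiplicity L k ≡ 0
multiplicity-≡0 {L = L} h = sum-map-≡0 L (toℕ-lookup-∉ ∘ h)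

multiplicity-≡1 : ∀ {n} {L : List (Subset n)} {u k} → Unique L → u ∈ₗ L → k ∈ u →
                  (∀ {t} → t ∈ₗ L → k ∈ t → t ≡ u) → multiplicity L k ≡ 1
multiplicity-≡1 (u∉L ∷ _) (here refl) k∈u same =
  cong₂ _+_ (toℕ-lookup-∈ k∈u) (multiplicity-≡0 (λ t∈L k∈t → lookupᴬ u∉L t∈L (sym (same (there t∈L) k∈t))))
multiplicity-≡1 (t∉L ∷ uniq) (there u∈L) k∈u same =
  cong₂ _+_ (toℕ-lookup-∉ (λ k∈t → lookupᴬ t∉L u∈L (same (here refl) k∈t)))
            (multiplicity-≡1 uniq u∈L k∈u (same ∘ there))

sum-∣∩∣-multiplicity : ∀ {n} (L : List (Subset n)) (s X : Subset n) →
                       (∀ k → multiplicity L k ≡ toℕ (lookup s k)) →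
                       sum (map (λ t → ∣ t ∩ X ∣) L) ≡ ∣ s ∩ X ∣
sum-∣∩∣-multiplicity L [] [] _ = sum-map-≡0 L (λ { {[]} _ → refl })
sum-∣∩∣-multiplicity L (b ∷ s) (x ∷ X) h = begin
  sum (map (λ t → ∣ t ∩ (x ∷ X) ∣) L)
    ≡⟨ cong sum (map-cong ∣∩∷∣ L) ⟩
  sum (map (λ t → toℕ (lookup t zero) * toℕ x + ∣ tail t ∩ X ∣) L)
    ≡⟨ sum-map-+ _ _ L ⟩
  sum (map (λ t → toℕ (lookup t zero) * toℕ x) L) + sum (map (λ t → ∣ tail t ∩ X ∣) L)
    ≡⟨ cong₂ _+_ (sum-map-*ʳ _ (toℕ x) L) (cong sum (map-∘ L)) ⟩
  multiplicity L zero * toℕ x + sum (map (λ t → ∣ t ∩ X ∣) (map tail L))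
    ≡⟨ cong₂ _+_ (cong (_* toℕ x) (h zero)) (sum-∣∩∣-multiplicity (map tail L) s X h-tail) ⟩
  toℕ b * toℕ x + ∣ s ∩ X ∣
    ≡⟨ sym (∣∩∷∣ (b ∷ s)) ⟩
  ∣ (b ∷ s) ∩ (x ∷ X) ∣ ∎
  where
  open ≡-Reasoning
  ∣∩∷∣ : ∀ t → ∣ t ∩ (x ∷ X) ∣ ≡ toℕ (lookup t zero) * toℕ x + ∣ tail t ∩ X ∣
  ∣∩∷∣ (a ∷ t) = trans (∣∷∣ (a ∧ x) (t ∩ X)) (cong (_+ ∣ t ∩ X ∣) (toℕ-∧ a x))
  h-tail : ∀ k → multiplicity (map tail L) k ≡ toℕ (lookup s k)
  h-tail k = trans (cong sum (sym (map-∘ L)))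
                   (trans (cong sum (map-cong (λ { (a ∷ t) → refl }) L)) (h (suc k)))

record IsPartition {n} (s : Subset n) (L : List (Subset n)) : Set where
  field
    unique   : Unique L
    ⊆-whole  : ∀ {t} → t ∈ₗ L → t ⊆ s
    cover    : ∀ {k} → k ∈ s → ∃[ t ] (t ∈ₗ L × k ∈ t)
    disjoint : ∀ {k t u} → t ∈ₗ L → u ∈ₗ L → k ∈ t → k ∈ u → t ≡ u

module _ {n} {s : Subset n} {L : List (Subset n)} (P : IsPartition s L) where
  open IsPartition P

  multiplicity-partition : ∀ k → multiplicity L k ≡ toℕ (lookup s k)
  multiplicity-partition k with k ∈? s
  ... | yes k∈s = let t , t∈L , k∈t = cover k∈s in
    trans (multiplicity-≡1 unique t∈L k∈t (λ u∈L k∈u → disjoint u∈L t∈L k∈u k∈t)) (sym (toℕ-lookup-∈ k∈s))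
  ... | no  k∉s = trans (multiplicity-≡0 (λ t∈L k∈t → k∉s (⊆-whole t∈L k∈t))) (sym (toℕ-lookup-∉ k∉s))

  sum-∣∩∣-partition : ∀ X → sum (map (λ t → ∣ t ∩ X ∣) L) ≡ ∣ s ∩ X ∣
  sum-∣∩∣-partition X = sum-∣∩∣-multiplicity L s X multiplicity-partition

_<∞_ : ℚ → ℚ∞ → Set
m <∞ fin q = m < q
m <∞ ∞     = ⊤

_<∞?_ : ∀ m x → Dec (m <∞ x)
m <∞? fin q = m <? q
m <∞? ∞     = yes tt

<∞⇒≤∞ : ∀ {m} x → m <∞ x → m ≤∞ x
<∞⇒≤∞ (fin q) m<q = <⇒≤ m<q
<∞⇒≤∞ ∞       _   = tt

<-≤∞-trans : ∀ {m d} x → m < d → d ≤∞ x → m <∞ x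
<-≤∞-trans (fin q) m<d d≤q = <-≤-trans m<d d≤q
<-≤∞-trans ∞       _   _   = tt

≤-≤∞-trans : ∀ {m d} x → m ≤ℚ d → d ≤∞ x → m ≤∞ x
≤-≤∞-trans (fin q) m≤d d≤q = ≤-trans m≤d d≤q
≤-≤∞-trans ∞       _   _   = tt

m<m+1 : ∀ m → m < m +ℚ 1ℚ
m<m+1 m = subst (_< m +ℚ 1ℚ) (+-identityʳ m) (+-monoʳ-< m (positive⁻¹ 1ℚ))

<∞-between : ∀ {m} x y → m <∞ x → m <∞ y → ∃[ d ] (m < d × d ≤∞ x × d ≤∞ y)
<∞-between (fin a) (fin b) m<a m<b with ≤-total a b
... | inj₁ a≤b = a , m<a , ≤-refl , a≤b
... | inj₂ b≤a = b , m<b , b≤a , ≤-refl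
<∞-between (fin a) ∞ m<a _ = a , m<a , ≤-refl , tt
<∞-between ∞ (fin b) _ m<b = b , m<b , tt , ≤-refl
<∞-between {m} ∞ ∞ _ _     = m +ℚ 1ℚ , m<m+1 m , tt , tt

FiniteMinimum : ∀ {n} → (Fin n → Set) → (Fin n → ℚ∞) → Set
FiniteMinimum P f = ∃[ j ] ∃[ q ] (P j × f j ≡ fin q × ∀ k → P k → q ≤∞ f k)

minimum-at-zero : ∀ {n} {P : Fin (suc n) → Set} {f r} → P zero → f zero ≡ fin r →
                  (∀ k → P (suc k) → r ≤∞ f (suc k)) → FiniteMinimum P f
minimum-at-zero P0 f0 r≤ = zero , _ , P0 , f0 , λ { zero _ → subst (_ ≤∞_) (sym f0) ≤-refl ; (suc k) → r≤ k }

minimum-at-suc : ∀ {n} {P : Fin (suc n) → Set} {f j q} → P (suc j) → f (suc j) ≡ fin q →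
                 (∀ k → P (suc k) → q ≤∞ f (suc k)) → (P zero → q ≤∞ f zero) → FiniteMinimum P f
minimum-at-suc Pj fj q≤ q≤f0 = suc _ , _ , Pj , fj , λ { zero → q≤f0 ; (suc k) → q≤ k }

finiteMinimum : ∀ {n} {P : Fin n → Set} → Decidable P → (f : Fin n → ℚ∞) →
                (∀ j → P j → f j ≡ ∞) ⊎ FiniteMinimum P f
finiteMinimum {zero}  P? f = inj₁ (λ ())
finiteMinimum {suc n} P? f with finiteMinimum (P? ∘ suc) (f ∘ suc) | P? zero | f zero in f0
... | inj₁ all∞ | no ¬P0 | _     = inj₁ λ { zero P0 → ⊥-elim (¬P0 P0) ; (suc j) → all∞ j }
... | inj₁ all∞ | yes _  | ∞     = inj₁ λ { zero _ → f0 ; (suc j) → all∞ j }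
... | inj₁ all∞ | yes P0 | fin r = inj₂ (minimum-at-zero P0 f0 λ k Pk → subst (r ≤∞_) (sym (all∞ k Pk)) tt)
... | inj₂ (_ , _ , Pj , fj , q≤) | no ¬P0 | _ = inj₂ (minimum-at-suc Pj fj q≤ λ P0 → ⊥-elim (¬P0 P0))
... | inj₂ (_ , _ , Pj , fj , q≤) | yes _  | ∞ = inj₂ (minimum-at-suc Pj fj q≤ λ _ → subst (_ ≤∞_) (sym f0) tt)
... | inj₂ (_ , q , Pj , fj , q≤) | yes P0 | fin r with r ≤? q
...   | yes r≤q = inj₂ (minimum-at-zero P0 f0 λ k Pk → ≤-≤∞-trans (f (suc k)) r≤q (q≤ k Pk))
...   | no  r≰q = inj₂ (minimum-at-suc Pj fj q≤ λ _ → subst (q ≤∞_) (sym f0) (<⇒≤ (≰⇒> r≰q)))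

gap-above : ∀ {n} (m : ℚ) (f : Fin n → ℚ∞) → ∃[ d ] (m < d × ∀ k → m <∞ f k → d ≤∞ f k)
gap-above m f with finiteMinimum (λ k → m <∞? f k) f
... | inj₁ all∞ = m +ℚ 1ℚ , m<m+1 m , λ k m<fk → subst (_ ≤∞_) (sym (all∞ k m<fk)) tt
... | inj₂ (_ , q , m<fj , fj≡q , q≤) = q , subst (m <∞_) fj≡q m<fj , q≤

module Ultrametric (U : UltrametricSpace) where
  open UltrametricSpace U

  ≤∞-val-sym : ∀ {d} x y → d ≤∞ val x y → d ≤∞ val y x
  ≤∞-val-sym {d} x y = subst (d ≤∞_) (val-sym x y)

  <∞-val-sym : ∀ {d} x y → d <∞ val x y → d <∞ val y x
  <∞-val-sym {d} x y = subst (d <∞_) (val-sym x y)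

  val-ultra-< : ∀ {m} x y z → m <∞ val x y → m <∞ val y z → m <∞ val x z
  val-ultra-< x y z m<xy m<yz with <∞-between (val x y) (val y z) m<xy m<yz
  ... | d , m<d , d≤xy , d≤yz = <-≤∞-trans (val x z) m<d (val-ultra x y z d d≤xy d≤yz)

module Discs (U : UltrametricSpace) {n : ℕ} (root : Fin n → UltrametricSpace.Point U) where
  open UltrametricSpace U
  open Ultrametric U
  open ClusterPicture U root

  v : Fin n → Fin n → ℚ∞
  v i j = val (root i) (root j)

  recentre : ∀ {s z d j} → IsDiscCut s z d → j ∈ s → IsDiscCut s (root j) d
  recentre {z = z} {d} {j} D j∈s k = mk⇔
    (λ k∈s → val-ultra (root k) z (root j) d (to (D k) k∈s) (≤∞-val-sym (root j) z (to (D j) j∈s)))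
    (λ d≤ → from (D k) (val-ultra (root k) (root j) z d d≤ (to (D j) j∈s)))

  openDisc : Fin n → ℚ → Subset n
  openDisc j m = tabulate (λ k → does (m <∞? v k j))

  ∈-openDisc⁺ : ∀ {j m k} → m <∞ v k j → k ∈ openDisc j m
  ∈-openDisc⁺ {j} {m} {k} m<v = ∈-tabulate⁺ (dec-true (m <∞? v k j) m<v)

  ∈-openDisc⁻ : ∀ {j m k} → k ∈ openDisc j m → m <∞ v k j
  ∈-openDisc⁻ {j} {m} {k} k∈ with m <∞? v k j | trans (sym (lookup∘tabulate _ k)) ([]=⇒lookup k∈)
  ... | yes m<v | _ = m<v
  ... | no  _   | ()

  centre∈openDisc : ∀ j m → j ∈ openDisc j m
  centre∈openDisc j m = ∈-openDisc⁺ (subst (m <∞_) (sym (val-self (root j))) tt)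

  openDisc-isCluster : ∀ j m → IsCluster (openDisc j m)
  openDisc-isCluster j m with gap-above m (λ k → v k j)
  ... | d , m<d , gap = (j , centre∈openDisc j m) , root j , d ,
        λ k → mk⇔ (gap k ∘ ∈-openDisc⁻) (∈-openDisc⁺ ∘ <-≤∞-trans (v k j) m<d)

  _≟ₛ_ : (p q : Subset n) → Dec (p ≡ q)
  _≟ₛ_ = ≡-dec _≟ᴮ_

  open import Data.List.Relation.Unary.Unique.DecPropositional.Properties _≟ₛ_ using (deduplicate-!)

  -- m is the depth of s, the least valuation v i j for i, j ∈ s
  record IsDepth (s : Subset n) (m : ℚ) : Set where
    field
      discCut  : ∀ {j} → j ∈ s → IsDiscCut s (root j) m
      attained : ∃[ i ] ∃[ j ] (i ∈ s × j ∈ s × v i j ≡ fin m)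

  depth : Injective _≡_ _≡_ root → ∀ {s} → IsCluster s → ∣ s ∣ ≢ 1 → ∃ (IsDepth s)
  depth inj {s} ((c , c∈s) , z , d , D) ∣s∣≢1 with finiteMinimum (_∈? s) (λ k → v k c)
  ... | inj₁ all∞ = contradiction (trans (cong ∣_∣ s≡⁅c⁆) (∣⁅x⁆∣≡1 c)) ∣s∣≢1
    where
    s≡⁅c⁆ : s ≡ ⁅ c ⁆
    s≡⁅c⁆ = ⊆-antisym (λ k∈s → subst (_∈ ⁅ c ⁆) (sym (inj (val-∞ _ _ (all∞ _ k∈s)))) (x∈⁅x⁆ c))
                      (λ k∈⁅c⁆ → subst (_∈ s) (sym (x∈⁅y⁆⇒x≡y c k∈⁅c⁆)) c∈s)
  ... | inj₂ (i , m , i∈s , vic≡m , m≤) =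
    m , record { discCut = recentre Dm ; attained = i , c , i∈s , c∈s , vic≡m }
    where
    Dc : IsDiscCut s (root c) d
    Dc = recentre D c∈s
    d≤m : d ≤ℚ m
    d≤m = subst (d ≤∞_) vic≡m (to (Dc i) i∈s)
    Dm : IsDiscCut s (root c) m
    Dm k = mk⇔ (m≤ k) (from (Dc k) ∘ ≤-≤∞-trans (v k c) d≤m)

  module Children {s : Subset n} {m : ℚ} (isDepth : IsDepth s m) where
    open IsDepth isDepth

    openDisc⊆ : ∀ {j} → j ∈ s → openDisc j m ⊆ s
    openDisc⊆ {j} j∈s {k} k∈ = from (discCut j∈s k) (<∞⇒≤∞ (v k j) (∈-openDisc⁻ k∈))

    -- the two roots realising the depth cannot lie in a common open disc of radius m
    openDisc⊂ : ∀ {j} → j ∈ s → openDisc j m ⊂ s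
    openDisc⊂ {j} j∈s with attained
    ... | a , c , a∈s , c∈s , vac≡m with c ∈? openDisc j m
    ...   | no  c∉ = openDisc⊆ j∈s , c , c∈s , c∉
    ...   | yes c∈ = openDisc⊆ j∈s , a , a∈s , λ a∈ → <-irrefl refl
              (subst (m <∞_) vac≡m (val-ultra-< (root a) (root j) (root c) (∈-openDisc⁻ a∈)
                                                (<∞-val-sym (root c) (root j) (∈-openDisc⁻ c∈))))

    ⊂-cluster⊆openDisc : ∀ {u j} → IsCluster u → j ∈ u → u ⊂ s → u ⊆ openDisc j m
    ⊂-cluster⊆openDisc {u} {j} (_ , z , e , Du) j∈u (u⊆s , k , k∈s , k∉u) {x} x∈u =
      ∈-openDisc⁺ (<-≤∞-trans (v x j) m<e (to (Dj x) x∈u))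
      where
      Dj : IsDiscCut u (root j) e
      Dj = recentre Du j∈u
      m<e : m < e
      m<e = ≰⇒> λ e≤m → k∉u (from (Dj k) (≤-≤∞-trans (v k j) e≤m (to (discCut (u⊆s j∈u) k) k∈s)))

    openDisc-isChild : ∀ {j} → j ∈ s → IsChild s (openDisc j m)
    openDisc-isChild {j} j∈s = openDisc-isCluster j m , openDisc⊂ j∈s ,
      λ u cl (D⊆u , x , x∈u , x∉D) u⊂s → x∉D (⊂-cluster⊆openDisc cl (D⊆u (centre∈openDisc j m)) u⊂s x∈u)

    child≡openDisc : ∀ {t k} → IsChild s t → k ∈ t → t ≡ openDisc k m
    child≡openDisc {t} {k} (cl , t⊂s , maximal) k∈t = ⊆-antisym t⊆D D⊆t
      where
      t⊆D : t ⊆ openDisc k m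
      t⊆D = ⊂-cluster⊆openDisc cl k∈t t⊂s
      D⊆t : openDisc k m ⊆ t
      D⊆t {x} x∈D with x ∈? t
      ... | yes x∈t = x∈t
      ... | no  x∉t = ⊥-elim (maximal (openDisc k m) (openDisc-isCluster k m) (t⊆D , x , x∈D , x∉t)
                                      (openDisc⊂ (p⊂q⇒p⊆q t⊂s k∈t)))

    childList : ∃ (ChildList s)
    childList = L , deduplicate-! _ , λ t → mk⇔ ∈L⇒child child⇒∈L
      where
      L : List (Subset n)
      L = deduplicate _≟ₛ_ (map (λ j → openDisc j m) (filter (_∈? s) (allFin n)))
      ∈L⇒child : ∀ {t} → t ∈ₗ L → IsChild s t
      ∈L⇒child t∈L with ∈-map⁻ _ (from (deduplicate-∈⇔ _≟ₛ_) t∈L)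
      ... | j , j∈ , refl = openDisc-isChild (proj₂ (∈-filter⁻ (_∈? s) {xs = allFin n} j∈))
      child⇒∈L : ∀ {t} → IsChild s t → t ∈ₗ L
      child⇒∈L ch@(((k , k∈t) , _) , t⊂s , _) rewrite child≡openDisc ch k∈t =
        to (deduplicate-∈⇔ _≟ₛ_) (∈-map⁺ _ (∈-filter⁺ (_∈? s) (∈-allFin k) (p⊂q⇒p⊆q t⊂s k∈t)))

    ChildList⇒IsPartition : ∀ {L} → ChildList s L → IsPartition s L
    ChildList⇒IsPartition {L} (unique , ∈⇔child) = record
      { unique   = unique
      ; ⊆-whole  = λ t∈L → p⊂q⇒p⊆q (proj₁ (proj₂ (child t∈L)))
      ; cover    = λ {k} k∈s → openDisc k m , from (∈⇔child _) (openDisc-isChild k∈s) , centre∈openDisc k m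
      ; disjoint = λ t∈L u∈L k∈t k∈u →
          trans (child≡openDisc (child t∈L) k∈t) (sym (child≡openDisc (child u∈L) k∈u))
      }
      where
      child : ∀ {t} → t ∈ₗ L → IsChild s t
      child = to (∈⇔child _)

open UltrametricSpace using (Point)
open ClusterPicture using (IsCluster; IsChromatic; R₁; R₂)

module Colouring (U : UltrametricSpace) {n : ℕ} (root : Fin n → Point U) (inj : Injective _≡_ _≡_ root)
                 (rc : Fin n → RootColour) (col : Subset n → Colour) (chr : IsChromatic U root rc col) where
  open ClusterPicture U root using (ChildList; redChildren; blueChildren)
  open Discs U root
  open IsChromatic chr

  reds blues : Subset n
  reds  = R₁ U root rc
  blues = R₂ U root rc

  redChildren≡sum : ∀ L → redChildren col L ≡ sum (map (redWeight ∘ col) L)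
  redChildren≡sum []      = refl
  redChildren≡sum (t ∷ L) = cong (redWeight (col t) +_) (redChildren≡sum L)

  blueChildren≡sum : ∀ L → blueChildren col L ≡ sum (map (blueWeight ∘ col) L)
  blueChildren≡sum []      = refl
  blueChildren≡sum (t ∷ L) = cong (blueWeight (col t) +_) (blueChildren≡sum L)

  ColouredByCounts : Subset n → Set
  ColouredByCounts s = col s ≡ colourFromCounts ∣ s ∩ reds ∣ ∣ s ∩ blues ∣

  singleton-colour : ∀ {s i} → ∣ s ∣ ≡ 1 → i ∈ s →
                     colourFromCounts ∣ s ∩ reds ∣ ∣ s ∩ blues ∣ ≡ rootToColour (rc i)
  singleton-colour {s} {i} ∣s∣≡1 i∈s with rc i in e | trans (sym (∣∣≡∣∩red∣+∣∩blue∣ rc s)) ∣s∣≡1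
  ... | red  | total≡1 =
    colourFromCounts-red _ _ total≡1 (∈⇒1≤∣∣ (x∈p∩q⁺ (i∈s , ∈-tabulate⁺ (cong isRedRoot e))))
  ... | blue | total≡1 =
    colourFromCounts-blue _ _ total≡1 (∈⇒1≤∣∣ (x∈p∩q⁺ (i∈s , ∈-tabulate⁺ (cong isBlueRoot e))))

  redWeight-parity : ∀ {t} → ColouredByCounts t → parity (redWeight (col t)) ≡ parity ∣ t ∩ reds ∣
  redWeight-parity {t} e =
    trans (cong (parity ∘ redWeight) e) (parity-redWeight ∣ t ∩ reds ∣ ∣ t ∩ blues ∣)

  blueWeight-parity : ∀ {t} → ColouredByCounts t → parity (blueWeight (col t)) ≡ parity ∣ t ∩ blues ∣
  blueWeight-parity {t} e =
    trans (cong (parity ∘ blueWeight) e) (parity-blueWeight ∣ t ∩ reds ∣ ∣ t ∩ blues ∣)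

  colour-from-children : ∀ {s L} → IsPartition s L → (∀ {t} → t ∈ₗ L → ColouredByCounts t) →
    colourFromCounts (redChildren col L) (blueChildren col L) ≡ colourFromCounts ∣ s ∩ reds ∣ ∣ s ∩ blues ∣
  colour-from-children {s} {L} P ih =
    colourFromCounts-cong {redChildren col L} {∣ s ∩ reds ∣} {blueChildren col L} {∣ s ∩ blues ∣}
      (trans (cong parity (redChildren≡sum L)) (weight-parity redWeight reds (redWeight-parity ∘ ih)))
      (trans (cong parity (blueChildren≡sum L)) (weight-parity blueWeight blues (blueWeight-parity ∘ ih)))
    where
    weight-parity : ∀ (w : Colour → ℕ) X → (∀ {t} → t ∈ₗ L → parity (w (col t)) ≡ parity ∣ t ∩ X ∣) →
                    parity (sum (map (w ∘ col) L)) ≡ parity ∣ s ∩ X ∣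
    weight-parity w X h = trans (parity-sum-map-cong L h) (cong parity (sum-∣∩∣-partition P X))

  colour-of-cluster : ∀ {s} → IsCluster U root s → ColouredByCounts s
  colour-of-cluster = go (⊂-wellFounded _)
    where
    go : ∀ {s} → Acc _⊂_ s → IsCluster U root s → ColouredByCounts s
    go {s} (acc rec) cl@((i , i∈s) , _) with ∣ s ∣ ≟ 1
    ... | yes ∣s∣≡1 = trans (singleton s i cl ∣s∣≡1 i∈s) (sym (singleton-colour ∣s∣≡1 i∈s))
    ... | no  ∣s∣≢1 with depth inj cl ∣s∣≢1
    ...   | _ , isDepth with Children.childList isDepth
    ...     | L , childL = trans (nonSingleton s L cl childL ∣s∣≢1)
                                 (colour-from-children (Children.ChildList⇒IsPartition isDepth childL) ih)
      where
      ih : ∀ {t} → t ∈ₗ L → ColouredByCounts t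
      ih t∈L with to (proj₂ childL _) t∈L
      ... | clt , t⊂s , _ = go (rec t⊂s) clt

lemma2p5 : (U : UltrametricSpace) (n : ℕ) (root : Fin n → Point U) → Injective _≡_ _≡_ root →
           (rc : Fin n → RootColour) (col : Subset n → Colour) → IsChromatic U root rc col →
           (s : Subset n) → IsCluster U root s →
           (Odd ∣ s ∣ → col s ≡ red ⊎ col s ≡ blue) ×
           (Even ∣ s ∣ → col s ≡ purple ⊎ col s ≡ black) ×
           (col s ≡ purple → Odd ∣ s ∩ R₁ U root rc ∣ × Odd ∣ s ∩ R₂ U root rc ∣ × Even ∣ s ∣) ×
           (col s ≡ red → Odd ∣ s ∩ R₁ U root rc ∣ × Even ∣ s ∩ R₂ U root rc ∣ × Odd ∣ s ∣) ×
           (col s ≡ blue → Even ∣ s ∩ R₁ U root rc ∣ × Odd ∣ s ∩ R₂ U root rc ∣ × Odd ∣ s ∣) ×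
           (col s ≡ black → Even ∣ s ∩ R₁ U root rc ∣ × Even ∣ s ∩ R₂ U root rc ∣ × Even ∣ s ∣)
lemma2p5 U n root inj rc col chr s cl
  rewrite Colouring.colour-of-cluster U root inj rc col chr cl
        | ∣∣≡∣∩red∣+∣∩blue∣ rc s
  = colourFromCounts-classification ∣ s ∩ R₁ U root rc ∣ ∣ s ∩ R₂ U root rc ∣
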